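{- Let $m\ge 2$ and let $G$ be a chain hexagonal cactus of length $m$ with hexagons $h_1,\dots,h_m$ in chain order. Let $c$ be the cut vertex shared by $h_{m-1}$ and $h_m$, and let $b$ and $i$ be the two neighbours of $c$ in the hexagon $h_{m-1}$. Let $H$ be the subgraph of $G$ induced by the vertices of $h_1,\dots,h_{m-1}$. Then at least one of the following holds: (i) $2\,\Psi(H-\{b,c\})\ge \Psi(H-c)$; (ii) $2\,\Psi(H-\{c,i\})\ge \Psi(H-c)$.
   Context: All graphs are finite and simple. A matching of a graph $G$ is a set of edges no two of which share a vertex; it is maximal if it is not a proper subset of another matching of $G$. $\Psi(G)$ denotes the number of maximal matchings of $G$. For a set $S$ of vertices, $G-S$ (or $G-v$ if $S=\{v\}$) is the graph obtained by deleting the vertices of $S$ and all edges incident to them. A hexagon is a cycle on 6 vertices. A chain hexagonal cactus of length $m\ge1$ is a graph that is the union of $m$ hexagons $h_1,\dots,h_m$ such that $h_j$ and $h_{j+1}$ share exactly one vertex (a cut vertex) for $1\le j\le m-1$, and $h_j,h_k$ are vertex-disjoint whenever $|j-k|\ge 2$. -}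

module Defs where

open import Data.Nat using (ℕ; zero; suc; _<ᵇ_; _≤_; _+_)
open import Data.Bool using (Bool; true; false; _∧_; _∨_; not)
open import Data.Fin using (Fin; zero; suc; toℕ; _≟_)
open import Data.Product using (Σ; _×_; _,_; ∃)
open import Data.List using (List; []; _∷_; map; _++_; length; allFin; concatMap)
open import Data.Bool.ListAction using (any; all)
open import Relation.Nullary using (¬_)
open import Relation.Nullary.Decidable using (⌊_⌋)
open import Relation.Binary.PropositionalEquality using (_≡_)

-- A (simple) graph whose vertices form a subset of Fin n.
-- `vert x` says whether x is a vertex; `adj` is the (symmetric) adjacency.
record Graph (n : ℕ) : Set where
  field
    vert : Fin n → Bool
    adj  : Fin n → Fin n → Bool
open Graph public

_==_ : ∀ {n} → Fin n → Fin n → Bool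
x == y = ⌊ x ≟ y ⌋

filterᵇ : ∀ {A : Set} → (A → Bool) → List A → List A
filterᵇ p [] = []
filterᵇ p (x ∷ xs) with p x
... | true  = x ∷ filterᵇ p xs
... | false = filterᵇ p xs

-- An edge {u,v} is recorded as the pair (u , v) with u < v.
Edge : ℕ → Set
Edge n = Fin n × Fin n

edgeEq : ∀ {n} → Edge n → Edge n → Bool
edgeEq (a , b) (c , d) = (a == c) ∧ (b == d)

edges : ∀ {n} → Graph n → List (Edge n)
edges {n} G =
  concatMap (λ u → map (λ v → (u , v))
    (filterᵇ (λ v → (toℕ u <ᵇ toℕ v) ∧ vert G u ∧ vert G v ∧ adj G u v)
            (allFin n)))
  (allFin n)

subsets : ∀ {A : Set} → List A → List (List A)
subsets [] = [] ∷ []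
subsets (x ∷ xs) = map (x ∷_) (subsets xs) ++ subsets xs

touch : ∀ {n} → Edge n → Edge n → Bool
touch (a , b) (c , d) = (a == c) ∨ (a == d) ∨ (b == c) ∨ (b == d)

isMatching : ∀ {n} → List (Edge n) → Bool
isMatching [] = true
isMatching (e ∷ es) = not (any (touch e) es) ∧ isMatching es

_∈ᵇ_ : ∀ {n} → Edge n → List (Edge n) → Bool
e ∈ᵇ M = any (edgeEq e) M

properSubset : ∀ {n} → List (Edge n) → List (Edge n) → Bool
properSubset M M' = all (_∈ᵇ M') M ∧ any (λ e → not (e ∈ᵇ M)) M'

isMaximalMatching : ∀ {n} → Graph n → List (Edge n) → Bool
isMaximalMatching G M =
  isMatching M ∧ not (any (λ M' → isMatching M' ∧ properSubset M M') (subsets (edges G)))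

Ψ : ∀ {n} → Graph n → ℕ
Ψ G = length (filterᵇ (isMaximalMatching G) (subsets (edges G)))

deleteVs : ∀ {n} → Graph n → List (Fin n) → Graph n
deleteVs G S = record { vert = λ x → vert G x ∧ not (any (_==_ x) S) ; adj = adj G }

induced : ∀ {n} → Graph n → (Fin n → Bool) → Graph n
induced G P = record { vert = λ x → vert G x ∧ P x ; adj = adj G }

next : Fin 6 → Fin 6
next zero = suc zero
next (suc zero) = suc (suc zero)
next (suc (suc zero)) = suc (suc (suc zero))
next (suc (suc (suc zero))) = suc (suc (suc (suc zero)))
next (suc (suc (suc (suc zero)))) = suc (suc (suc (suc (suc zero))))
next (suc (suc (suc (suc (suc zero))))) = zero

prev : Fin 6 → Fin 6
prev zero = suc (suc (suc (suc (suc zero))))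
prev (suc zero) = zero
prev (suc (suc zero)) = suc zero
prev (suc (suc (suc zero))) = suc (suc zero)
prev (suc (suc (suc (suc zero)))) = suc (suc (suc zero))
prev (suc (suc (suc (suc (suc zero))))) = suc (suc (suc (suc zero)))

-- A family of m hexagons in Fin n: hexagon j is the 6-cycle
-- hex j 0, hex j 1, ..., hex j 5, hex j 0.
Hexagons : ℕ → ℕ → Set
Hexagons m n = Fin m → Fin 6 → Fin n

onHex : ∀ {m n} → Hexagons m n → Fin m → Fin n → Bool
onHex hex j x = any (λ k → hex j k == x) (allFin 6)

unionGraph : ∀ {m n} → Hexagons m n → Graph n
unionGraph {m} hex = record
  { vert = λ x → any (λ j → onHex hex j x) (allFin m)
  ; adj  = λ u v → any (λ j → any (λ k →
              ((hex j k == u) ∧ (hex j (next k) == v)) ∨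
              ((hex j k == v) ∧ (hex j (next k) == u))) (allFin 6)) (allFin m)
  }

Common : ∀ {m n} → Hexagons m n → Fin m → Fin m → Fin n → Set
Common hex j j' v = (Σ (Fin 6) λ k → hex j k ≡ v) × (Σ (Fin 6) λ k → hex j' k ≡ v)

record IsChainHexCactus {m n : ℕ} (hex : Hexagons m n) : Set where
  field
    hexInjective : ∀ j k k' → hex j k ≡ hex j k' → k ≡ k'
    consecShare  : ∀ j j' → toℕ j' ≡ suc (toℕ j) →
                   Σ (Fin n) λ v → Common hex j j' v × (∀ w → Common hex j j' w → w ≡ v)
    farDisjoint  : ∀ j j' → suc (suc (toℕ j)) ≤ toℕ j' → ∀ k k' → ¬ (hex j k ≡ hex j' k')

-- x lies on one of the hexagons with (0-based) index < r, i.e. on h_1,...,h_r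
onHexBefore : ∀ {m n} → Hexagons m n → ℕ → Fin n → Bool
onHexBefore {m} hex r x = any (λ j → (toℕ j <ᵇ r) ∧ onHex hex j x) (allFin m)

module Submission where

-- Let K = h_{m-1}, let c be the cut vertex shared with h_m, and let b, i be
-- the neighbours of c on K.  The proof has a general and a structural part.
--
-- (1) Pendant-vertex bound.  If a vertex x of a graph G has at most one
--     neighbour w, then Ψ(G) ≤ 2 Ψ(G - x).  A maximal matching M of G is sent
--     to the pair (does M cover x?, M'), where M' consists of the edges of M
--     avoiding x, extended, if that is no longer maximal in G - x, by the first
--     free edge of G - x (such an edge necessarily passes through w).  M can
--     be recovered from this pair, so the maximal matchings of G inject into
--     two copies of those of G - x.
-- (2) Cactus structure.  Since K meets h_{m-2} in exactly one vertex and
--     b ≠ i, one of b, i does not lie on h_{m-2} (nor on any earlier hexagon,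
--     by disjointness; for m = 2 there is none); it is not c either, so it
--     lies on K only, and in H - c its only neighbour is its other neighbour
--     on K.  Applying (1) to H - c with x = b or x = i gives (i) or (ii).

open import Defs
open import Data.Bool using (Bool; true; false; _∧_; _∨_; not; T)
open import Data.Bool.ListAction using (any; all)
open import Data.Empty using (⊥; ⊥-elim)
open import Data.Fin using (Fin; zero; suc; toℕ; fromℕ; inject₁) renaming (_≟_ to _≟F_)
open import Data.Fin.Properties using (toℕ-injective; toℕ-inject₁; toℕ-fromℕ; toℕ<n)
open import Data.List using (List; []; _∷_; _++_; map; length; allFin; concatMap)
open import Data.List.Properties using (length-++; length-map; ∷-injectiveʳ)
open import Data.List.Membership.Propositional using (_∈_)
open import Data.List.Membership.Propositional.Properties
  using (∈-map⁺; ∈-map⁻; ∈-++⁺ˡ; ∈-++⁺ʳ; ∈-++⁻; ∈-∃++; ∈-allFin; ∈-concatMap⁺; ∈-concatMap⁻)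
open import Data.List.Relation.Binary.Sublist.Propositional using (_⊆_; []; _∷_; _∷ʳ_; lookup)
open import Data.List.Relation.Unary.Any using (here; there; satisfied)
import Data.List.Relation.Unary.Any as Any
import Data.List.Relation.Unary.All as All
import Data.List.Relation.Unary.AllPairs as AllPairs
open import Data.List.Relation.Unary.Unique.Propositional using (Unique)
import Data.List.Relation.Unary.Unique.Propositional.Properties as Unique
open import Data.Maybe using (Maybe; just; nothing)
open import Data.Maybe.Properties using (just-injective)
open import Data.Nat using (ℕ; zero; suc; _+_; _*_; _≤_; _<_; _≥_; s≤s; z≤n; _<ᵇ_)
open import Data.Nat.Properties
  using (+-suc; +-identityʳ; ≤-trans; ≤-reflexive; ≤-antisym; ≤-pred; <ᵇ⇒<; <-asym; <-cmp;
         m≤n⇒m<n∨m≡n; suc-injective)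
open import Data.Product using (Σ; _×_; _,_; proj₁; proj₂)
open import Data.Sum using (_⊎_; inj₁; inj₂) renaming (map to map-⊎)
open import Data.Unit using (tt)
open import Relation.Binary.Definitions using (tri<; tri≈; tri>)
open import Relation.Binary.PropositionalEquality
open import Relation.Nullary using (¬_; yes; no)

bool-cases : (b : Bool) → b ≡ true ⊎ b ≡ false
bool-cases true = inj₁ refl
bool-cases false = inj₂ refl

clash : ∀ {a} → a ≡ true → a ≡ false → ⊥
clash refl ()

∧-elimˡ : ∀ {a b} → a ∧ b ≡ true → a ≡ true
∧-elimˡ {true} _ = refl

∧-elimʳ : ∀ {a b} → a ∧ b ≡ true → b ≡ true
∧-elimʳ {true} h = h

∧-intro : ∀ {a b} → a ≡ true → b ≡ true → a ∧ b ≡ true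
∧-intro refl refl = refl

∧-elim₄ : ∀ {a b c d} → a ∧ b ∧ c ∧ d ≡ true → a ≡ true × b ≡ true × c ≡ true × d ≡ true
∧-elim₄ {true} {true} {true} {true} _ = refl , refl , refl , refl

∨-elim : ∀ {a b} → a ∨ b ≡ true → a ≡ true ⊎ b ≡ true
∨-elim {true} _ = inj₁ refl
∨-elim {false} h = inj₂ h

∨-introˡ : ∀ {a b} → a ≡ true → a ∨ b ≡ true
∨-introˡ refl = refl

∨-introʳ : ∀ {a b} → b ≡ true → a ∨ b ≡ true
∨-introʳ {true} _ = refl
∨-introʳ {false} h = h

not-elim : ∀ {a} → not a ≡ true → a ≡ false
not-elim {false} _ = refl

not-intro : ∀ {a} → a ≡ false → not a ≡ true
not-intro refl = refl

module _ {n : ℕ} where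

  ==-sound : {x y : Fin n} → x == y ≡ true → x ≡ y
  ==-sound {x} {y} h with x ≟F y | h
  ... | yes e | _ = e
  ... | no _ | ()

  ==-complete : {x y : Fin n} → x ≡ y → x == y ≡ true
  ==-complete {x} {y} e with x ≟F y
  ... | yes _ = refl
  ... | no x≢y = ⊥-elim (x≢y e)

  ==-false : {x y : Fin n} → x ≢ y → x == y ≡ false
  ==-false {x} {y} x≢y with x ≟F y
  ... | yes e = ⊥-elim (x≢y e)
  ... | no _ = refl

module _ {A : Set} where

  any-witness : (p : A → Bool) (xs : List A) → any p xs ≡ true → Σ A λ x → x ∈ xs × p x ≡ true
  any-witness p (x ∷ xs) h with ∨-elim {p x} h
  ... | inj₁ px = x , here refl , px
  ... | inj₂ h' with any-witness p xs h'
  ...   | y , y∈xs , py = y , there y∈xs , py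

  any-intro : (p : A → Bool) {xs : List A} {x : A} → x ∈ xs → p x ≡ true → any p xs ≡ true
  any-intro p (here refl) px = ∨-introˡ px
  any-intro p {y ∷ _} (there x∈xs) px = ∨-introʳ {p y} (any-intro p x∈xs px)

  any-false : (p : A → Bool) {xs : List A} {x : A} → any p xs ≡ false → x ∈ xs → p x ≡ true → ⊥
  any-false p h x∈xs px = clash (any-intro p x∈xs px) h

  all-intro : (p : A → Bool) (xs : List A) → (∀ x → x ∈ xs → p x ≡ true) → all p xs ≡ true
  all-intro p [] h = refl
  all-intro p (x ∷ xs) h = ∧-intro (h x (here refl)) (all-intro p xs (λ y m → h y (there m)))

  all-elim : (p : A → Bool) (xs : List A) → all p xs ≡ true → ∀ x → x ∈ xs → p x ≡ true
  all-elim p (y ∷ xs) h x (here refl) = ∧-elimˡ h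
  all-elim p (y ∷ xs) h x (there m) = all-elim p xs (∧-elimʳ {p y} h) x m

  ∈-filter⁻ : (p : A → Bool) (xs : List A) {e : A} → e ∈ filterᵇ p xs → e ∈ xs × p e ≡ true
  ∈-filter⁻ p (x ∷ xs) m with p x in px
  ∈-filter⁻ p (x ∷ xs) (here refl) | true = here refl , px
  ∈-filter⁻ p (x ∷ xs) (there m) | true = let e∈xs , pe = ∈-filter⁻ p xs m in there e∈xs , pe
  ∈-filter⁻ p (x ∷ xs) m | false = let e∈xs , pe = ∈-filter⁻ p xs m in there e∈xs , pe

  ∈-filter⁺ : (p : A → Bool) (xs : List A) {e : A} → e ∈ xs → p e ≡ true → e ∈ filterᵇ p xs
  ∈-filter⁺ p (x ∷ xs) (here refl) pe with p x | pe
  ... | true | _ = here refl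
  ... | false | ()
  ∈-filter⁺ p (x ∷ xs) (there m) pe with p x
  ... | true = there (∈-filter⁺ p xs m pe)
  ... | false = ∈-filter⁺ p xs m pe

  filter-unique : (p : A → Bool) (xs : List A) → Unique xs → Unique (filterᵇ p xs)
  filter-unique p [] u = u
  filter-unique p (x ∷ xs) (x∉xs AllPairs.∷ u) with p x
  ... | true = All.tabulate (λ m → All.lookup x∉xs (proj₁ (∈-filter⁻ p xs m))) AllPairs.∷ filter-unique p xs u
  ... | false = filter-unique p xs u

  ∈-subsets⁻ : (U : List A) {M : List A} → M ∈ subsets U → M ⊆ U
  ∈-subsets⁻ [] (here refl) = []
  ∈-subsets⁻ (x ∷ xs) m with ∈-++⁻ (map (x ∷_) (subsets xs)) m
  ... | inj₂ m' = x ∷ʳ ∈-subsets⁻ xs m'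
  ... | inj₁ m' with ∈-map⁻ (x ∷_) m'
  ...   | t , t∈ , refl = refl ∷ ∈-subsets⁻ xs t∈

  filter-∈-subsets : (p : A → Bool) (U : List A) → filterᵇ p U ∈ subsets U
  filter-∈-subsets p [] = here refl
  filter-∈-subsets p (x ∷ xs) with p x
  ... | true = ∈-++⁺ˡ (∈-map⁺ (x ∷_) (filter-∈-subsets p xs))
  ... | false = ∈-++⁺ʳ (map (x ∷_) (subsets xs)) (filter-∈-subsets p xs)

  subsets-unique : (U : List A) → Unique U → Unique (subsets U)
  subsets-unique [] u = All.[] AllPairs.∷ AllPairs.[]
  subsets-unique (x ∷ xs) (x∉xs AllPairs.∷ u) =
    Unique.++⁺ (Unique.map⁺ ∷-injectiveʳ (subsets-unique xs u)) (subsets-unique xs u) disjoint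
    where
    disjoint : ∀ {v} → ¬ (v ∈ map (x ∷_) (subsets xs) × v ∈ subsets xs)
    disjoint (m₁ , m₂) with ∈-map⁻ (x ∷_) m₁
    ... | t , _ , refl = All.lookup x∉xs (lookup (∈-subsets⁻ xs m₂) (here refl)) refl

  sublist-ext : ∀ {U M M' : List A} → Unique U → M ⊆ U → M' ⊆ U →
                (∀ e → e ∈ M → e ∈ M') → (∀ e → e ∈ M' → e ∈ M) → M ≡ M'
  sublist-ext u [] [] to fro = refl
  sublist-ext {x ∷ U} (x∉U AllPairs.∷ u) (refl ∷ s) (refl ∷ s') to fro =
    cong (_ ∷_) (sublist-ext u s s' (λ e m → tail (lookup s m) (to e (there m)))
                                    (λ e m → tail (lookup s' m) (fro e (there m))))
    where
    tail : ∀ {e L} → e ∈ U → e ∈ x ∷ L → e ∈ L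
    tail e∈U (here refl) = ⊥-elim (All.lookup x∉U e∈U refl)
    tail e∈U (there m) = m
  sublist-ext (x∉U AllPairs.∷ u) (refl ∷ s) (_ ∷ʳ s') to fro =
    ⊥-elim (All.lookup x∉U (lookup s' (to _ (here refl))) refl)
  sublist-ext (x∉U AllPairs.∷ u) (_ ∷ʳ s) (refl ∷ s') to fro =
    ⊥-elim (All.lookup x∉U (lookup s (fro _ (here refl))) refl)
  sublist-ext (_ AllPairs.∷ u) (_ ∷ʳ s) (_ ∷ʳ s') to fro = sublist-ext u s s' to fro

pigeonhole : {A B : Set} (f : A → B) (xs : List A) (ys : List B) → Unique xs →
             (∀ a → a ∈ xs → f a ∈ ys) →
             (∀ a a' → a ∈ xs → a' ∈ xs → f a ≡ f a' → a ≡ a') → length xs ≤ length ys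
pigeonhole f [] ys u into inj = z≤n
pigeonhole f (a ∷ as) ys (a∉as AllPairs.∷ u) into inj with ∈-∃++ (into a (here refl))
... | ys₁ , ys₂ , refl =
  ≤-trans (s≤s (pigeonhole f as (ys₁ ++ ys₂) u into' (λ b b' m m' → inj b b' (there m) (there m'))))
          (≤-reflexive (sym length-split))
  where
  into' : ∀ b → b ∈ as → f b ∈ ys₁ ++ ys₂
  into' b m with ∈-++⁻ ys₁ (into b (there m))
  ... | inj₁ q = ∈-++⁺ˡ q
  ... | inj₂ (here e) = ⊥-elim (All.lookup a∉as m (sym (inj b a (there m) (here refl) e)))
  ... | inj₂ (there q) = ∈-++⁺ʳ ys₁ q
  length-split : length (ys₁ ++ f a ∷ ys₂) ≡ suc (length (ys₁ ++ ys₂))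
  length-split = begin
    length (ys₁ ++ f a ∷ ys₂)           ≡⟨ length-++ ys₁ ⟩
    length ys₁ + suc (length ys₂)       ≡⟨ +-suc (length ys₁) (length ys₂) ⟩
    suc (length ys₁ + length ys₂)       ≡⟨ cong suc (sym (length-++ ys₁)) ⟩
    suc (length (ys₁ ++ ys₂))           ∎
    where open ≡-Reasoning

module _ {n : ℕ} where

  Inc : Fin n → Edge n → Set
  Inc z (a , b) = z ≡ a ⊎ z ≡ b

  incᵇ : Fin n → Edge n → Bool
  incᵇ z (a , b) = (z == a) ∨ (z == b)

  incᵇ-sound : ∀ z e → incᵇ z e ≡ true → Inc z e
  incᵇ-sound z (a , b) h with ∨-elim {z == a} h
  ... | inj₁ q = inj₁ (==-sound q)
  ... | inj₂ q = inj₂ (==-sound q)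

  incᵇ-complete : ∀ z e → Inc z e → incᵇ z e ≡ true
  incᵇ-complete z (a , b) (inj₁ q) = ∨-introˡ (==-complete q)
  incᵇ-complete z (a , b) (inj₂ q) = ∨-introʳ {z == a} (==-complete q)

  inc? : ∀ (z : Fin n) (e : Edge n) → Inc z e ⊎ ¬ Inc z e
  inc? z e with bool-cases (incᵇ z e)
  ... | inj₁ q = inj₁ (incᵇ-sound z e q)
  ... | inj₂ q = inj₂ (λ i → clash (incᵇ-complete z e i) q)

  touch-sound : ∀ e f → touch e f ≡ true → Σ (Fin n) λ z → Inc z e × Inc z f
  touch-sound (a , b) (c , d) h with ∨-elim {a == c} h
  ... | inj₁ q = a , inj₁ refl , inj₁ (==-sound q)
  ... | inj₂ h₂ with ∨-elim {a == d} h₂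
  ...   | inj₁ q = a , inj₁ refl , inj₂ (==-sound q)
  ...   | inj₂ h₃ with ∨-elim {b == c} h₃
  ...     | inj₁ q = b , inj₂ refl , inj₁ (==-sound q)
  ...     | inj₂ q = b , inj₂ refl , inj₂ (==-sound q)

  touch-complete : ∀ z e f → Inc z e → Inc z f → touch e f ≡ true
  touch-complete z (a , b) (c , d) (inj₁ refl) (inj₁ refl) = ∨-introˡ (==-complete {x = a} refl)
  touch-complete z (a , b) (c , d) (inj₁ refl) (inj₂ refl) =
    ∨-introʳ {a == c} (∨-introˡ (==-complete {x = a} refl))
  touch-complete z (a , b) (c , d) (inj₂ refl) (inj₁ refl) =
    ∨-introʳ {a == c} (∨-introʳ {a == d} (∨-introˡ (==-complete {x = b} refl)))
  touch-complete z (a , b) (c , d) (inj₂ refl) (inj₂ refl) =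
    ∨-introʳ {a == c} (∨-introʳ {a == d} (∨-introʳ {b == c} (==-complete {x = b} refl)))

  touch-refl : ∀ e → touch e e ≡ true
  touch-refl (a , b) = touch-complete a (a , b) (a , b) (inj₁ refl) (inj₁ refl)

  touch-sym : ∀ e f → touch e f ≡ true → touch f e ≡ true
  touch-sym e f h = let z , z∈e , z∈f = touch-sound e f h in touch-complete z f e z∈f z∈e

  edgeEq-sound : ∀ (e f : Edge n) → edgeEq e f ≡ true → e ≡ f
  edgeEq-sound (a , b) (c , d) h = cong₂ _,_ (==-sound (∧-elimˡ h)) (==-sound (∧-elimʳ {a == c} h))

  edgeEq-refl : ∀ (e : Edge n) → edgeEq e e ≡ true
  edgeEq-refl (a , b) = ∧-intro (==-complete {x = a} refl) (==-complete {x = b} refl)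

  ∈ᵇ-sound : ∀ (e : Edge n) M → e ∈ᵇ M ≡ true → e ∈ M
  ∈ᵇ-sound e M h with any-witness (edgeEq e) M h
  ... | f , f∈M , q rewrite edgeEq-sound e f q = f∈M

  ∈ᵇ-complete : ∀ (e : Edge n) {M} → e ∈ M → e ∈ᵇ M ≡ true
  ∈ᵇ-complete e m = any-intro (edgeEq e) m (edgeEq-refl e)

  Matching : List (Edge n) → Set
  Matching M = ∀ a b → a ∈ M → b ∈ M → touch a b ≡ true → a ≡ b

  Dominates : List (Edge n) → List (Edge n) → Set
  Dominates M U = ∀ f → f ∈ U → f ∈ M ⊎ Σ (Edge n) λ g → g ∈ M × touch f g ≡ true

  isMatching-sound : ∀ M → isMatching M ≡ true → Matching M
  isMatching-sound (h ∷ t) im a b (here refl) (here refl) tab = refl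
  isMatching-sound (h ∷ t) im a b (here refl) (there b∈t) tab =
    ⊥-elim (clash (any-intro (touch h) b∈t tab) (not-elim (∧-elimˡ im)))
  isMatching-sound (h ∷ t) im a b (there a∈t) (here refl) tab =
    ⊥-elim (clash (any-intro (touch h) a∈t (touch-sym a h tab)) (not-elim (∧-elimˡ im)))
  isMatching-sound (h ∷ t) im a b (there a∈t) (there b∈t) tab =
    isMatching-sound t (∧-elimʳ {not (any (touch h) t)} im) a b a∈t b∈t tab

  isMatching-complete : ∀ M → Unique M → Matching M → isMatching M ≡ true
  isMatching-complete [] u mt = refl
  isMatching-complete (h ∷ t) (h∉t AllPairs.∷ u) mt with bool-cases (any (touch h) t)
  ... | inj₁ q = let b , b∈t , tb = any-witness (touch h) t q
                 in ⊥-elim (All.lookup h∉t b∈t (mt h b (here refl) (there b∈t) tb))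
  ... | inj₂ q rewrite q = isMatching-complete t u (λ a b a∈t b∈t → mt a b (there a∈t) (there b∈t))

  maximalᵇ : List (Edge n) → List (Edge n) → Bool
  maximalᵇ U M = isMatching M ∧ not (any (λ M' → isMatching M' ∧ properSubset M M') (subsets U))

  maximal-complete : ∀ U M → isMatching M ≡ true → Dominates M U → maximalᵇ U M ≡ true
  maximal-complete U M im dom with bool-cases (any (λ M' → isMatching M' ∧ properSubset M M') (subsets U))
  ... | inj₂ q rewrite im | q = refl
  ... | inj₁ q with any-witness _ (subsets U) q
  ... | M' , M'∈ , h with any-witness (λ e → not (e ∈ᵇ M)) M' (∧-elimʳ {all (_∈ᵇ M') M} (∧-elimʳ {isMatching M'} h))
  ... | e , e∈M' , e∉M with dom e (lookup (∈-subsets⁻ U M'∈) e∈M')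
  ... | inj₁ e∈M = ⊥-elim (clash (∈ᵇ-complete e e∈M) (not-elim e∉M))
  ... | inj₂ (g , g∈M , tg) =
    let g∈M' = ∈ᵇ-sound g M' (all-elim (_∈ᵇ M') M (∧-elimˡ (∧-elimʳ {isMatching M'} h)) g g∈M)
        e≡g = isMatching-sound M' (∧-elimˡ h) e g e∈M' g∈M' tg
    in ⊥-elim (clash (∈ᵇ-complete e (subst (_∈ M) (sym e≡g) g∈M)) (not-elim e∉M))

  -- a maximal matching dominates U: otherwise adding a free edge enlarges it
  maximal-dominates : ∀ U M → Unique U → M ⊆ U → maximalᵇ U M ≡ true → Dominates M U
  maximal-dominates U M uU M⊆U h f f∈U with bool-cases (f ∈ᵇ M)
  ... | inj₁ q = inj₁ (∈ᵇ-sound f M q)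
  ... | inj₂ q with bool-cases (any (touch f) M)
  ...   | inj₁ r = let g , g∈M , tg = any-witness (touch f) M r in inj₂ (g , g∈M , tg)
  ...   | inj₂ r = ⊥-elim (clash enlarged (not-elim (∧-elimʳ {isMatching M} h)))
    where
    P : Edge n → Bool
    P e = e ∈ᵇ M ∨ edgeEq e f
    M' : List (Edge n)
    M' = filterᵇ P U
    ∈M' : ∀ {a} → a ∈ M' → a ∈ M ⊎ a ≡ f
    ∈M' {a} a∈M' with ∨-elim {a ∈ᵇ M} (proj₂ (∈-filter⁻ P U a∈M'))
    ... | inj₁ x = inj₁ (∈ᵇ-sound a M x)
    ... | inj₂ x = inj₂ (edgeEq-sound a f x)
    matching : Matching M'
    matching a b a∈ b∈ tab with ∈M' a∈ | ∈M' b∈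
    ... | inj₁ x | inj₁ y = isMatching-sound M (∧-elimˡ h) a b x y tab
    ... | inj₁ x | inj₂ refl = ⊥-elim (any-false (touch f) r x (touch-sym a f tab))
    ... | inj₂ refl | inj₁ y = ⊥-elim (any-false (touch f) r y tab)
    ... | inj₂ refl | inj₂ refl = refl
    proper : properSubset M M' ≡ true
    proper = ∧-intro (all-intro (_∈ᵇ M') M (λ a a∈M → ∈ᵇ-complete a (∈-filter⁺ P U (lookup M⊆U a∈M) (∨-introˡ (∈ᵇ-complete a a∈M)))))
                     (any-intro (λ e → not (e ∈ᵇ M)) (∈-filter⁺ P U f∈U (∨-introʳ {f ∈ᵇ M} (edgeEq-refl f))) (not-intro q))
    enlarged : any (λ M' → isMatching M' ∧ properSubset M M') (subsets U) ≡ true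
    enlarged = any-intro (λ M' → isMatching M' ∧ properSubset M M') (filter-∈-subsets P U)
                         (∧-intro (isMatching-complete M' (filter-unique P U uU) matching) proper)

module _ {n : ℕ} where

  firstFree : List (Edge n) → List (Edge n) → Maybe (Edge n)
  firstFree R [] = nothing
  firstFree R (e ∷ L) with any (touch e) R
  ... | true = firstFree R L
  ... | false = just e

  firstFree-just : ∀ R L g → firstFree R L ≡ just g → g ∈ L × any (touch g) R ≡ false
  firstFree-just R (e ∷ L) g h with any (touch e) R in q
  ... | true = let g∈L , free = firstFree-just R L g h in there g∈L , free
  ... | false with h
  ...   | refl = here refl , q

  firstFree-nothing : ∀ R L → firstFree R L ≡ nothing → ∀ f → f ∈ L → any (touch f) R ≡ true
  firstFree-nothing R (e ∷ L) h f m with any (touch e) R in q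
  firstFree-nothing R (e ∷ L) h f (here refl) | true = q
  firstFree-nothing R (e ∷ L) h f (there m) | true = firstFree-nothing R L h f m
  firstFree-nothing R (e ∷ L) () f m | false

  isJust : Maybe (Edge n) → Edge n → Bool
  isJust nothing e = false
  isJust (just g) e = edgeEq e g

  isJust-sound : ∀ m a → isJust m a ≡ true → m ≡ just a
  isJust-sound (just g) a h = cong just (sym (edgeEq-sound a g h))

module PendantCount {n : ℕ} (U U⁻ : List (Edge n)) (x y : Fin n)
  (U-unique : Unique U) (U⁻-unique : Unique U⁻)
  (avoid⁺ : ∀ f → f ∈ U → ¬ Inc x f → f ∈ U⁻)
  (avoid⁻ : ∀ f → f ∈ U⁻ → f ∈ U × ¬ Inc x f)
  (at-most-one : ∀ f g → f ∈ U → g ∈ U → Inc x f → Inc x g → f ≡ g)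
  (pendant : ∀ f → f ∈ U → Inc x f → f ≡ (x , y) ⊎ f ≡ (y , x)) where

  Ed : Set
  Ed = Edge n

  pendant-y : ∀ f → f ∈ U → Inc x f → Inc y f
  pendant-y f f∈U xf with pendant f f∈U xf
  ... | inj₁ refl = inj₂ refl
  ... | inj₂ refl = inj₁ refl

  pendant-ends : ∀ f → f ∈ U → Inc x f → ∀ z → Inc z f → z ≡ x ⊎ z ≡ y
  pendant-ends f f∈U xf z zf with pendant f f∈U xf | zf
  ... | inj₁ refl | inj₁ e = inj₁ e
  ... | inj₁ refl | inj₂ e = inj₂ e
  ... | inj₂ refl | inj₁ e = inj₂ e
  ... | inj₂ refl | inj₂ e = inj₁ e

  through-y : ∀ (g h : Ed) → h ∈ U → Inc x h → ¬ Inc x g → touch g h ≡ true → Inc y g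
  through-y g h h∈U xh ¬xg t with touch-sound g h t
  ... | z , zg , zh with pendant-ends h h∈U xh z zh
  ...   | inj₁ refl = ⊥-elim (¬xg zg)
  ...   | inj₂ refl = zg

  IsMaximal : List Ed → Set
  IsMaximal M = M ⊆ U × Matching M × Dominates M U

  -- M is encoded by coversX M and the maximal matching reduce M of U⁻
  coversX : List Ed → Bool
  coversX M = any (incᵇ x) M

  rest : List Ed → List Ed
  rest M = filterᵇ (_∈ᵇ M) U⁻

  extra : List Ed → Maybe Ed
  extra M = firstFree (rest M) U⁻

  inReduce : List Ed → Ed → Bool
  inReduce M e = e ∈ᵇ M ∨ isJust (extra M) e

  reduce : List Ed → List Ed
  reduce M = filterᵇ (inReduce M) U⁻

  rest-∈ : ∀ M e → e ∈ U⁻ → e ∈ M → e ∈ rest M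
  rest-∈ M e e∈U⁻ e∈M = ∈-filter⁺ (_∈ᵇ M) U⁻ e∈U⁻ (∈ᵇ-complete e e∈M)

  reduce-∈⁻ : ∀ M a → a ∈ reduce M → a ∈ U⁻ × (a ∈ M ⊎ extra M ≡ just a)
  reduce-∈⁻ M a m with ∈-filter⁻ (inReduce M) U⁻ m
  ... | a∈U⁻ , p with ∨-elim {a ∈ᵇ M} p
  ...   | inj₁ q = a∈U⁻ , inj₁ (∈ᵇ-sound a M q)
  ...   | inj₂ q = a∈U⁻ , inj₂ (isJust-sound (extra M) a q)

  reduce-∈-kept : ∀ M a → a ∈ U⁻ → a ∈ M → a ∈ reduce M
  reduce-∈-kept M a a∈U⁻ a∈M = ∈-filter⁺ (inReduce M) U⁻ a∈U⁻ (∨-introˡ (∈ᵇ-complete a a∈M))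

  reduce-∈-extra : ∀ M g → extra M ≡ just g → g ∈ U⁻ → g ∈ reduce M
  reduce-∈-extra M g eq g∈U⁻ =
    ∈-filter⁺ (inReduce M) U⁻ g∈U⁻ (∨-introʳ {g ∈ᵇ M} (subst (λ m → isJust m g ≡ true) (sym eq) (edgeEq-refl g)))

  extra-spec : ∀ M → IsMaximal M → ∀ g → extra M ≡ just g →
               g ∈ U⁻ × any (touch g) (rest M) ≡ false × Σ Ed λ h → h ∈ M × Inc x h × Inc y g
  extra-spec M (M⊆U , _ , dom) g eq with firstFree-just (rest M) U⁻ g eq
  ... | g∈U⁻ , free with avoid⁻ g g∈U⁻
  ... | g∈U , ¬xg with dom g g∈U
  ... | inj₁ g∈M = ⊥-elim (any-false (touch g) free (rest-∈ M g g∈U⁻ g∈M) (touch-refl g))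
  ... | inj₂ (h , h∈M , tgh) with inc? x h
  ...   | inj₂ ¬xh = ⊥-elim (any-false (touch g) free (rest-∈ M h (avoid⁺ h (lookup M⊆U h∈M) ¬xh) h∈M) tgh)
  ...   | inj₁ xh = g∈U⁻ , free , h , h∈M , xh , through-y g h (lookup M⊆U h∈M) xh ¬xg tgh

  reduce-matching : ∀ M → IsMaximal M → Matching (reduce M)
  reduce-matching M mx@(_ , match , _) a b a∈ b∈ tab with reduce-∈⁻ M a a∈ | reduce-∈⁻ M b b∈
  ... | _ , inj₁ a∈M | _ , inj₁ b∈M = match a b a∈M b∈M tab
  ... | a∈U⁻ , inj₁ a∈M | _ , inj₂ eb =
    let _ , free , _ = extra-spec M mx b eb
    in ⊥-elim (any-false (touch b) free (rest-∈ M a a∈U⁻ a∈M) (touch-sym a b tab))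
  ... | _ , inj₂ ea | b∈U⁻ , inj₁ b∈M =
    let _ , free , _ = extra-spec M mx a ea
    in ⊥-elim (any-false (touch a) free (rest-∈ M b b∈U⁻ b∈M) tab)
  ... | _ , inj₂ ea | _ , inj₂ eb = just-injective (trans (sym ea) eb)

  -- an edge f of U⁻ that was dominated only by the edge at x is dominated by
  -- an edge of rest M or, failing that, by the added edge (both pass through y)
  reduce-dominates-via-x : ∀ M → IsMaximal M → ∀ f → f ∈ U⁻ → ¬ Inc x f →
    ∀ h → h ∈ M → Inc x h → touch f h ≡ true →
    ∀ m → extra M ≡ m → f ∈ reduce M ⊎ Σ Ed λ g → g ∈ reduce M × touch f g ≡ true
  reduce-dominates-via-x M mx f f∈U⁻ ¬xf h h∈M xh tfh nothing eq
    with any-witness (touch f) (rest M) (firstFree-nothing (rest M) U⁻ eq f f∈U⁻)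
  ... | r , r∈rest , tfr with ∈-filter⁻ (_∈ᵇ M) U⁻ r∈rest
  ...   | r∈U⁻ , r∈M = inj₂ (r , reduce-∈-kept M r r∈U⁻ (∈ᵇ-sound r M r∈M) , tfr)
  reduce-dominates-via-x M mx f f∈U⁻ ¬xf h h∈M xh tfh (just g) eq with extra-spec M mx g eq
  ... | g∈U⁻ , _ , _ , _ , _ , yg =
    inj₂ (g , reduce-∈-extra M g eq g∈U⁻ ,
          touch-complete y f g (through-y f h (lookup (proj₁ mx) h∈M) xh ¬xf tfh) yg)

  reduce-dominates : ∀ M → IsMaximal M → Dominates (reduce M) U⁻
  reduce-dominates M mx@(M⊆U , _ , dom) f f∈U⁻ with avoid⁻ f f∈U⁻
  ... | f∈U , ¬xf with dom f f∈U
  ... | inj₁ f∈M = inj₁ (reduce-∈-kept M f f∈U⁻ f∈M)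
  ... | inj₂ (h , h∈M , tfh) with inc? x h
  ...   | inj₂ ¬xh = inj₂ (h , reduce-∈-kept M h (avoid⁺ h (lookup M⊆U h∈M) ¬xh) h∈M , tfh)
  ...   | inj₁ xh = reduce-dominates-via-x M mx f f∈U⁻ ¬xf h h∈M xh tfh (extra M) refl

  Maximals Maximals⁻ : List (List Ed)
  Maximals = filterᵇ (maximalᵇ U) (subsets U)
  Maximals⁻ = filterᵇ (maximalᵇ U⁻) (subsets U⁻)

  reduce-maximal : ∀ M → IsMaximal M → reduce M ∈ Maximals⁻
  reduce-maximal M mx = ∈-filter⁺ (maximalᵇ U⁻) (subsets U⁻) (filter-∈-subsets (inReduce M) U⁻)
    (maximal-complete U⁻ (reduce M)
      (isMatching-complete (reduce M) (filter-unique (inReduce M) U⁻ U⁻-unique) (reduce-matching M mx))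
      (reduce-dominates M mx))

  Maximals-sound : ∀ M → M ∈ Maximals → IsMaximal M
  Maximals-sound M m with ∈-filter⁻ (maximalᵇ U) (subsets U) m
  ... | M∈ , mx = let M⊆U = ∈-subsets⁻ U M∈
                  in M⊆U , isMatching-sound M (∧-elimˡ mx) , maximal-dominates U M U-unique M⊆U mx

  -- membership in M, read off from the code (coversX M , reduce M):
  -- either e is the edge at x (and M covers x), or e is in reduce M and is not
  -- the added edge (which is added only when M covers x, and passes through y)
  Decoded : Bool → List Ed → Ed → Set
  Decoded covers R e = (covers ≡ true × Inc x e) ⊎ (e ∈ R × (covers ≡ false ⊎ ¬ Inc y e))

  decode-complete : ∀ M → IsMaximal M → ∀ e → e ∈ M → Decoded (coversX M) (reduce M) e
  decode-complete M (M⊆U , match , _) e e∈M with inc? x e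
  ... | inj₁ xe = inj₁ (any-intro (incᵇ x) e∈M (incᵇ-complete x e xe) , xe)
  ... | inj₂ ¬xe = inj₂ (reduce-∈-kept M e (avoid⁺ e (lookup M⊆U e∈M) ¬xe) e∈M , uncovered-or-off-y (bool-cases (coversX M)))
    where
    -- if M covers x by h, then e (which avoids x) cannot pass through y ∈ h
    uncovered-or-off-y : coversX M ≡ true ⊎ coversX M ≡ false → coversX M ≡ false ⊎ ¬ Inc y e
    uncovered-or-off-y (inj₂ no-x) = inj₁ no-x
    uncovered-or-off-y (inj₁ has-x) with any-witness (incᵇ x) M has-x
    ... | h , h∈M , ih = inj₂ λ ye → ¬xe (subst (Inc x) (sym (e≡h ye)) xh)
      where
      xh : Inc x h
      xh = incᵇ-sound x h ih
      e≡h : Inc y e → e ≡ h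
      e≡h ye = match e h e∈M h∈M (touch-complete y e h ye (pendant-y h (lookup M⊆U h∈M) xh))

  decode-sound : ∀ M → IsMaximal M → ∀ e → e ∈ U → Decoded (coversX M) (reduce M) e → e ∈ M
  decode-sound M (M⊆U , _ , _) e e∈U (inj₁ (has-x , xe)) with any-witness (incᵇ x) M has-x
  ... | h , h∈M , ih = subst (_∈ M) (sym (at-most-one e h e∈U (lookup M⊆U h∈M) xe (incᵇ-sound x h ih))) h∈M
  decode-sound M mx e e∈U (inj₂ (e∈R , side)) with reduce-∈⁻ M e e∈R
  ... | _ , inj₁ e∈M = e∈M
  ... | _ , inj₂ eq with extra-spec M mx e eq | side
  ...   | _ , _ , h , h∈M , xh , _  | inj₁ no-x = ⊥-elim (clash (any-intro (incᵇ x) h∈M (incᵇ-complete x h xh)) no-x)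
  ...   | _ , _ , _ , _ , _ , ye | inj₂ ¬ye = ⊥-elim (¬ye ye)

  code : List Ed → Bool × List Ed
  code M = coversX M , reduce M

  tag : Bool → List Ed → Bool × List Ed
  tag b M = b , M

  twoCopies : List (Bool × List Ed)
  twoCopies = map (tag true) Maximals⁻ ++ map (tag false) Maximals⁻

  code-∈ : ∀ M → M ∈ Maximals → code M ∈ twoCopies
  code-∈ M m with bool-cases (coversX M)
  ... | inj₁ q rewrite q = ∈-++⁺ˡ (∈-map⁺ (tag true) (reduce-maximal M (Maximals-sound M m)))
  ... | inj₂ q rewrite q = ∈-++⁺ʳ (map (tag true) Maximals⁻) (∈-map⁺ (tag false) (reduce-maximal M (Maximals-sound M m)))

  -- M is determined by its code, since Decoded describes its members
  code-injective : ∀ M M' → M ∈ Maximals → M' ∈ Maximals → code M ≡ code M' → M ≡ M'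
  code-injective M M' m m' eq = sublist-ext U-unique (proj₁ mx) (proj₁ mx') (transfer mx mx' eq) (transfer mx' mx (sym eq))
    where
    mx : IsMaximal M
    mx = Maximals-sound M m
    mx' : IsMaximal M'
    mx' = Maximals-sound M' m'
    transfer : ∀ {A B} → IsMaximal A → IsMaximal B → code A ≡ code B → ∀ e → e ∈ A → e ∈ B
    transfer {A} {B} a b eq e e∈A =
      decode-sound B b e (lookup (proj₁ a) e∈A)
        (subst (λ cd → Decoded (proj₁ cd) (proj₂ cd) e) eq (decode-complete A a e e∈A))

  -- the code injects the maximal matchings of U into two copies of those of U⁻
  maximal-count : length Maximals ≤ 2 * length Maximals⁻
  maximal-count = ≤-trans
    (pigeonhole code Maximals twoCopies (filter-unique (maximalᵇ U) (subsets U) (subsets-unique U U-unique)) code-∈ code-injective)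
    (≤-reflexive (begin
      length twoCopies
        ≡⟨ length-++ (map (tag true) Maximals⁻) ⟩
      length (map (tag true) Maximals⁻) + length (map (tag false) Maximals⁻)
        ≡⟨ cong₂ _+_ (length-map (tag true) Maximals⁻) (length-map (tag false) Maximals⁻) ⟩
      length Maximals⁻ + length Maximals⁻
        ≡⟨ cong (length Maximals⁻ +_) (sym (+-identityʳ _)) ⟩
      2 * length Maximals⁻ ∎))
    where open ≡-Reasoning

module _ {n : ℕ} (G : Graph n) where

  IsEdgeᵇ : Fin n → Fin n → Bool
  IsEdgeᵇ u v = (toℕ u <ᵇ toℕ v) ∧ vert G u ∧ vert G v ∧ adj G u v

  edgesFrom : Fin n → List (Edge n)
  edgesFrom u = map (u ,_) (filterᵇ (IsEdgeᵇ u) (allFin n))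

  ∈-edges⁻ : ∀ u v → (u , v) ∈ edges G → IsEdgeᵇ u v ≡ true
  ∈-edges⁻ u v m with satisfied (∈-concatMap⁻ edgesFrom {xs = allFin n} m)
  ... | u' , m' with ∈-map⁻ (u' ,_) m'
  ...   | v' , v'∈ , refl = proj₂ (∈-filter⁻ (IsEdgeᵇ u') (allFin n) v'∈)

  ∈-edges⁺ : ∀ u v → IsEdgeᵇ u v ≡ true → (u , v) ∈ edges G
  ∈-edges⁺ u v h = ∈-concatMap⁺ edgesFrom {xs = allFin n}
    (Any.map (λ { refl → ∈-map⁺ (u ,_) (∈-filter⁺ (IsEdgeᵇ u) (allFin n) (∈-allFin v) h) }) (∈-allFin u))

  edges-unique : Unique (edges G)
  edges-unique = concat-unique (allFin n) (Unique.allFin⁺ n)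
    where
    source : ∀ {f u} → f ∈ edgesFrom u → proj₁ f ≡ u
    source {f} {u} m with ∈-map⁻ (u ,_) m
    ... | _ , _ , refl = refl
    concat-unique : (us : List (Fin n)) → Unique us → Unique (concatMap edgesFrom us)
    concat-unique [] _ = AllPairs.[]
    concat-unique (u ∷ us) (u∉us AllPairs.∷ uu) =
      Unique.++⁺ (Unique.map⁺ (cong proj₂) (filter-unique (IsEdgeᵇ u) (allFin n) (Unique.allFin⁺ n)))
                 (concat-unique us uu) disjoint
      where
      disjoint : ∀ {f} → ¬ (f ∈ edgesFrom u × f ∈ concatMap edgesFrom us)
      disjoint {f} (m₁ , m₂) = other-source us m₂ u∉us
        where
        -- f has source u, so it is not listed under any source v ≠ u
        other-source : ∀ vs → f ∈ concatMap edgesFrom vs → All.All (u ≢_) vs → ⊥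
        other-source (v ∷ vs) m (u≢v All.∷ u∉vs) with ∈-++⁻ (edgesFrom v) m
        ... | inj₁ q = u≢v (trans (sym (source m₁)) (source q))
        ... | inj₂ q = other-source vs q u∉vs

Adjacent : ∀ {n} → Graph n → Fin n → Fin n → Set
Adjacent G u v = adj G u v ≡ true ⊎ adj G v u ≡ true

-- G - x is described pointwise, since deleting several
-- vertices at once is not definitionally deleting them one by one.
pendant-bound : ∀ {n} (G G⁻ : Graph n) (x w : Fin n) →
  (∀ z → vert G⁻ z ≡ (vert G z ∧ not (z == x))) →
  (∀ u v → adj G⁻ u v ≡ adj G u v) →
  (∀ v → vert G v ≡ true → Adjacent G x v → v ≡ w) →
  Ψ G ≤ 2 * Ψ G⁻
pendant-bound {n} G G⁻ x w vert⁻ adj⁻ neighbour =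
  PendantCount.maximal-count (edges G) (edges G⁻) x w (edges-unique G) (edges-unique G⁻)
    avoid⁺ avoid⁻ at-most-one pendant
  where
  vert⁻-sound : ∀ z → vert G⁻ z ≡ true → vert G z ≡ true × z ≢ x
  vert⁻-sound z h rewrite vert⁻ z = ∧-elimˡ h , λ e → clash (==-complete e) (not-elim (∧-elimʳ {vert G z} h))
  vert⁻-complete : ∀ z → vert G z ≡ true → z ≢ x → vert G⁻ z ≡ true
  vert⁻-complete z h z≢x rewrite vert⁻ z | h | ==-false z≢x = refl
  avoid⁺ : ∀ f → f ∈ edges G → ¬ Inc x f → f ∈ edges G⁻
  avoid⁺ (u , v) m ¬xf with ∧-elim₄ {toℕ u <ᵇ toℕ v} (∈-edges⁻ G u v m)
  ... | u<v , vu , vv , uv = ∈-edges⁺ G⁻ u v (∧-intro u<v (∧-intro (vert⁻-complete u vu (λ e → ¬xf (inj₁ (sym e))))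
                               (∧-intro (vert⁻-complete v vv (λ e → ¬xf (inj₂ (sym e)))) (trans (adj⁻ u v) uv))))
  avoid⁻ : ∀ f → f ∈ edges G⁻ → f ∈ edges G × ¬ Inc x f
  avoid⁻ (u , v) m with ∧-elim₄ {toℕ u <ᵇ toℕ v} (∈-edges⁻ G⁻ u v m)
  ... | u<v , vu , vv , uv =
    ∈-edges⁺ G u v (∧-intro u<v (∧-intro (proj₁ (vert⁻-sound u vu)) (∧-intro (proj₁ (vert⁻-sound v vv)) (trans (sym (adj⁻ u v)) uv)))) ,
    λ { (inj₁ e) → proj₂ (vert⁻-sound u vu) (sym e) ; (inj₂ e) → proj₂ (vert⁻-sound v vv) (sym e) }
  pendant : ∀ f → f ∈ edges G → Inc x f → f ≡ (x , w) ⊎ f ≡ (w , x)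
  pendant (u , v) m xf with ∧-elim₄ {toℕ u <ᵇ toℕ v} (∈-edges⁻ G u v m) | xf
  ... | _ , _ , vv , uv | inj₁ refl = inj₁ (cong (x ,_) (neighbour v vv (inj₁ uv)))
  ... | _ , vu , _ , uv | inj₂ refl = inj₂ (cong (_, x) (neighbour u vu (inj₂ uv)))
  -- edges are stored with their smaller endpoint first, so (x , w) and (w , x)
  -- are not both edges
  ordered : ∀ u v → (u , v) ∈ edges G → toℕ u < toℕ v
  ordered u v m = <ᵇ⇒< (toℕ u) (toℕ v) (subst T (sym (∧-elimˡ (∈-edges⁻ G u v m))) tt)
  at-most-one : ∀ f g → f ∈ edges G → g ∈ edges G → Inc x f → Inc x g → f ≡ g
  at-most-one f g f∈ g∈ xf xg with pendant f f∈ xf | pendant g g∈ xg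
  ... | inj₁ refl | inj₁ refl = refl
  ... | inj₂ refl | inj₂ refl = refl
  ... | inj₁ refl | inj₂ refl = ⊥-elim (<-asym (ordered x w f∈) (ordered w x g∈))
  ... | inj₂ refl | inj₁ refl = ⊥-elim (<-asym (ordered w x f∈) (ordered x w g∈))

prev-next : ∀ t → prev (next t) ≡ t
prev-next zero = refl
prev-next (suc zero) = refl
prev-next (suc (suc zero)) = refl
prev-next (suc (suc (suc zero))) = refl
prev-next (suc (suc (suc (suc zero)))) = refl
prev-next (suc (suc (suc (suc (suc zero))))) = refl

next-prev : ∀ t → next (prev t) ≡ t
next-prev zero = refl
next-prev (suc zero) = refl
next-prev (suc (suc zero)) = refl
next-prev (suc (suc (suc zero))) = refl
next-prev (suc (suc (suc (suc zero)))) = refl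
next-prev (suc (suc (suc (suc (suc zero))))) = refl

next≢id : ∀ t → next t ≢ t
next≢id zero ()
next≢id (suc zero) ()
next≢id (suc (suc zero)) ()
next≢id (suc (suc (suc zero))) ()
next≢id (suc (suc (suc (suc zero)))) ()
next≢id (suc (suc (suc (suc (suc zero))))) ()

prev≢id : ∀ t → prev t ≢ t
prev≢id t e = next≢id t (sym (trans (sym (next-prev t)) (cong next e)))

next≢prev : ∀ t → next t ≢ prev t
next≢prev zero ()
next≢prev (suc zero) ()
next≢prev (suc (suc zero)) ()
next≢prev (suc (suc (suc zero))) ()
next≢prev (suc (suc (suc (suc zero)))) ()
next≢prev (suc (suc (suc (suc (suc zero))))) ()

-- Deleting the pair {u, v} is, pointwise, deleting one vertex after the other.
delete-pair-first : ∀ a u v → a ∧ not (u ∨ (v ∨ false)) ≡ (a ∧ not (v ∨ false)) ∧ not u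
delete-pair-first true true true = refl
delete-pair-first true true false = refl
delete-pair-first true false true = refl
delete-pair-first true false false = refl
delete-pair-first false u v = refl

delete-pair-second : ∀ a u v → a ∧ not (u ∨ (v ∨ false)) ≡ (a ∧ not (u ∨ false)) ∧ not v
delete-pair-second true true true = refl
delete-pair-second true true false = refl
delete-pair-second true false true = refl
delete-pair-second true false false = refl
delete-pair-second false u v = refl

module _ {m n : ℕ} (hex : Hexagons m n) where

  HexEdge : Fin n → Fin n → Set
  HexEdge u v = Σ (Fin m) λ j → Σ (Fin 6) λ t →
                (hex j t ≡ u × hex j (next t) ≡ v) ⊎ (hex j t ≡ v × hex j (next t) ≡ u)

  hexEdge-sym : ∀ {u v} → HexEdge u v → HexEdge v u
  hexEdge-sym (j , t , inj₁ e) = j , t , inj₂ e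
  hexEdge-sym (j , t , inj₂ e) = j , t , inj₁ e

  adj-union-sound : ∀ u v → adj (unionGraph hex) u v ≡ true → HexEdge u v
  adj-union-sound u v h with any-witness _ (allFin m) h
  ... | j , _ , h₂ with any-witness _ (allFin 6) h₂
  ...   | t , _ , h₃ with ∨-elim h₃
  ...     | inj₁ a = j , t , inj₁ (==-sound (∧-elimˡ a) , ==-sound (∧-elimʳ {hex j t == u} a))
  ...     | inj₂ a = j , t , inj₂ (==-sound (∧-elimˡ a) , ==-sound (∧-elimʳ {hex j t == v} a))

  adjacent-union-sound : ∀ {u v} → Adjacent (unionGraph hex) u v → HexEdge u v
  adjacent-union-sound {u} {v} (inj₁ h) = adj-union-sound u v h
  adjacent-union-sound {u} {v} (inj₂ h) = hexEdge-sym (adj-union-sound v u h)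

  single-hex-neighbours : ∀ K s v → (∀ t t' → hex K t ≡ hex K t' → t ≡ t') →
    (∀ j t → hex j t ≡ hex K s → j ≡ K) →
    HexEdge (hex K s) v → v ≡ hex K (next s) ⊎ v ≡ hex K (prev s)
  single-hex-neighbours K s v inj only (j , t , inj₁ (e₁ , e₂)) with only j t e₁
  ... | refl = inj₁ (trans (sym e₂) (cong (λ t' → hex K (next t')) (inj t s e₁)))
  single-hex-neighbours K s v inj only (j , t , inj₂ (e₁ , e₂)) with only j (next t) e₂
  ... | refl = inj₂ (trans (sym e₁) (cong (hex K) (begin
                 t               ≡⟨ sym (prev-next t) ⟩
                 prev (next t)   ≡⟨ cong prev (inj (next t) s e₂) ⟩
                 prev s          ∎)))
    where open ≡-Reasoning

-- In a chain hexagonal cactus, the two neighbours of a vertex of hexagon j'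
-- cannot both lie on the preceding hexagon j: they are distinct, and j and j'
-- share only one vertex.
neighbour-off-previous : ∀ {m n} {hex : Hexagons m n} → IsChainHexCactus hex →
  ∀ j j' → toℕ j' ≡ suc (toℕ j) → ∀ p →
  (∀ t → hex j t ≢ hex j' (next p)) ⊎ (∀ t → hex j t ≢ hex j' (prev p))
neighbour-off-previous {hex = hex} cac j j' consecutive p with IsChainHexCactus.consecShare cac j j' consecutive
... | a , _ , unique with hex j' (next p) ≟F a
...   | no next≢a = inj₁ λ t e → next≢a (unique _ ((t , e) , (next p , refl)))
...   | yes next≡a = inj₂ λ t e → next≢prev p (IsChainHexCactus.hexInjective cac j' (next p) (prev p)
          (trans next≡a (sym (unique _ ((t , e) , (prev p , refl))))))

toℕ-inject₁-fromℕ : ∀ k → toℕ (inject₁ (fromℕ k)) ≡ k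
toℕ-inject₁-fromℕ k = trans (toℕ-inject₁ (fromℕ k)) (toℕ-fromℕ k)

-- x does not lie on the hexagon with index k - 1 (vacuous when k = 0)
OffPrevious : ∀ {m n} → Hexagons m n → ℕ → Fin n → Set
OffPrevious hex k x = ∀ j t → suc (toℕ j) ≡ k → hex j t ≢ x

neighbour-off-previous-index : ∀ {n} k (hex : Hexagons (suc (suc k)) n) → IsChainHexCactus hex → ∀ p →
  OffPrevious hex k (hex (inject₁ (fromℕ k)) (next p)) ⊎ OffPrevious hex k (hex (inject₁ (fromℕ k)) (prev p))
neighbour-off-previous-index zero hex cac p = inj₁ (λ j t ())
neighbour-off-previous-index (suc k) hex cac p =
  map-⊎ off-previous off-previous (neighbour-off-previous cac prevK K consecutive p)
  where
  prevK K : Fin (suc (suc (suc k)))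
  prevK = inject₁ (inject₁ (fromℕ k))
  K = inject₁ (fromℕ (suc k))
  toℕ-prevK : toℕ prevK ≡ k
  toℕ-prevK = trans (toℕ-inject₁ _) (toℕ-inject₁-fromℕ k)
  consecutive : toℕ K ≡ suc (toℕ prevK)
  consecutive = trans (toℕ-inject₁-fromℕ (suc k)) (cong suc (sym toℕ-prevK))
  off-previous : ∀ {x} → (∀ t → hex prevK t ≢ x) → OffPrevious hex (suc k) x
  off-previous off j t j+1≡k+1 e =
    off t (subst (λ j' → hex j' t ≡ _) (toℕ-injective (trans (suc-injective j+1≡k+1) (sym toℕ-prevK))) e)

-- The setting of the theorem: hexagons with indices 0, ..., k + 1, where
-- K = h_{m-1} has index k and L = h_m has index k + 1, c = K p = L q, and
-- H is spanned by the hexagons with index ≤ k.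

module LastTwoHexagons {n k : ℕ} (hex : Hexagons (suc (suc k)) n) (cac : IsChainHexCactus hex)
  (c : Fin n) (p q : Fin 6)
  (c-on-K : hex (inject₁ (fromℕ k)) p ≡ c) (c-on-L : hex (fromℕ (suc k)) q ≡ c) where

  open IsChainHexCactus cac

  K L : Fin (suc (suc k))
  K = inject₁ (fromℕ k)
  L = fromℕ (suc k)

  H H-c : Graph n
  H = induced (unionGraph hex) (λ x → onHexBefore hex (suc k) x)
  H-c = deleteVs H (c ∷ [])

  b i : Fin n
  b = hex K (next p)
  i = hex K (prev p)

  toℕ-L : toℕ L ≡ suc (toℕ K)
  toℕ-L = trans (toℕ-fromℕ (suc k)) (cong suc (sym (toℕ-inject₁-fromℕ k)))

  -- a vertex of K other than c that avoids the previous hexagon lies on K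
  -- only: earlier hexagons are disjoint from K, and K meets L only in c
  only-on-K : ∀ s → hex K s ≢ c → OffPrevious hex k (hex K s) → ∀ j t → hex j t ≡ hex K s → j ≡ K
  only-on-K s s≢c off j t e with <-cmp (toℕ j) k
  ... | tri≈ _ j≡k _ = toℕ-injective (trans j≡k (sym (toℕ-inject₁-fromℕ k)))
  ... | tri< j<k _ _ with m≤n⇒m<n∨m≡n j<k
  ...   | inj₂ j+1≡k = ⊥-elim (off j t j+1≡k e)
  ...   | inj₁ j+1<k = ⊥-elim (farDisjoint j K (subst (suc (suc (toℕ j)) ≤_) (sym (toℕ-inject₁-fromℕ k)) j+1<k) t s e)
  only-on-K s s≢c off j t e | tri> _ _ k<j = ⊥-elim (s≢c (trans (shared-unique (hex K s) ((s , refl) , (t , on-L)))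
                                                            (sym (shared-unique c ((p , c-on-K) , (q , c-on-L))))))
    where
    j≡L : j ≡ L
    j≡L = toℕ-injective (trans (≤-antisym (≤-pred (toℕ<n j)) k<j) (sym (toℕ-fromℕ (suc k))))
    on-L : hex L t ≡ hex K s
    on-L = subst (λ j' → hex j' t ≡ hex K s) j≡L e
    shared-unique : ∀ v → Common hex K L v → v ≡ proj₁ (consecShare K L toℕ-L)
    shared-unique = proj₂ (proj₂ (consecShare K L toℕ-L))

  pendant-in-H-c : ∀ s w → hex K s ≢ c → OffPrevious hex k (hex K s) →
    (∀ v → v ≡ hex K (next s) ⊎ v ≡ hex K (prev s) → v ≢ c → v ≡ w) →
    ∀ v → vert H-c v ≡ true → Adjacent H-c (hex K s) v → v ≡ w
  pendant-in-H-c s w s≢c off other v v∈H-c adjacent =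
    other v (single-hex-neighbours hex K s v (hexInjective K) (only-on-K s s≢c off) (adjacent-union-sound hex adjacent))
            (λ v≡c → clash (∨-introˡ (==-complete v≡c)) (not-elim (∧-elimʳ {vert H v} v∈H-c)))

  case-b : OffPrevious hex k b → 2 * Ψ (deleteVs H (b ∷ c ∷ [])) ≥ Ψ H-c
  case-b off = pendant-bound H-c (deleteVs H (b ∷ c ∷ [])) b w
    (λ z → delete-pair-first (vert H z) (z == b) (z == c)) (λ u v → refl)
    (pendant-in-H-c (next p) w b≢c off other)
    where
    w : Fin n
    w = hex K (next (next p))
    b≢c : b ≢ c
    b≢c e = next≢id p (hexInjective K (next p) p (trans e (sym c-on-K)))
    other : ∀ v → v ≡ w ⊎ v ≡ hex K (prev (next p)) → v ≢ c → v ≡ w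
    other v (inj₁ e) _ = e
    other v (inj₂ e) v≢c = ⊥-elim (v≢c (trans e (trans (cong (hex K) (prev-next p)) c-on-K)))

  case-i : OffPrevious hex k i → 2 * Ψ (deleteVs H (c ∷ i ∷ [])) ≥ Ψ H-c
  case-i off = pendant-bound H-c (deleteVs H (c ∷ i ∷ [])) i w
    (λ z → delete-pair-second (vert H z) (z == c) (z == i)) (λ u v → refl)
    (pendant-in-H-c (prev p) w i≢c off other)
    where
    w : Fin n
    w = hex K (prev (prev p))
    i≢c : i ≢ c
    i≢c e = prev≢id p (hexInjective K (prev p) p (trans e (sym c-on-K)))
    other : ∀ v → v ≡ hex K (next (prev p)) ⊎ v ≡ w → v ≢ c → v ≡ w
    other v (inj₂ e) _ = e
    other v (inj₁ e) v≢c = ⊥-elim (v≢c (trans e (trans (cong (hex K) (next-prev p)) c-on-K)))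

mainTheorem5 : (n k : ℕ) (hex : Hexagons (suc (suc k)) n) → IsChainHexCactus hex →
    (c : Fin n) (p q : Fin 6) →
    hex (inject₁ (fromℕ k)) p ≡ c → hex (fromℕ (suc k)) q ≡ c →
    let G = unionGraph hex
        H = induced G (λ x → onHexBefore hex (suc k) x)
        b = hex (inject₁ (fromℕ k)) (next p)
        i = hex (inject₁ (fromℕ k)) (prev p)
    in (2 * Ψ (deleteVs H (b ∷ c ∷ [])) ≥ Ψ (deleteVs H (c ∷ [])))
       ⊎ (2 * Ψ (deleteVs H (c ∷ i ∷ [])) ≥ Ψ (deleteVs H (c ∷ [])))
mainTheorem5 n k hex cac c p q c-on-K c-on-L =
  map-⊎ case-b case-i (neighbour-off-previous-index k hex cac p)
  where open LastTwoHexagons hex cac c p q c-on-K c-on-L
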